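{- Consider an instance of UJSSP in which all jobs have the same success probability, i.e. $\pi_j=\pi$ for all $j\in J$ for some $\pi\in[0,1]$. Then the greedy algorithm returns an optimal solution, i.e. a set $S^*\subseteq J$ with $z(S^*)=\max_{S\subseteq J} z(S)$.
   Context: UJSSP (Unreliable Job Selection and Sequencing Problem): there is a set $J=\{1,\dots,n\}$ of jobs; job $j$ has a cost $c_j\ge 0$, a reward $r_j\ge 0$, and a success probability $\pi_j\in[0,1]$. For a subset $S\subseteq J$ and a sequence $\sigma$ of the jobs of $S$ (with $\sigma(k)$ the $k$-th job), the expected net profit is $z(S,\sigma)=\sum_{k=1}^{|S|} r_{\sigma(k)}\prod_{i=1}^{k}\pi_{\sigma(i)}-\sum_{j\in S}c_j$. Let $z(S)=\max_\sigma z(S,\sigma)$ (with $z(\emptyset)=0$). UJSSP asks for $S\subseteq J$ maximizing $z(S)$. The greedy algorithm: set $S_0=\emptyset$, $i=0$; while $i<n$ and there is a job $j\notin S_i$ with $z(S_i\cup\{j\})>z(S_i)$, choose a job $k\notin S_i$ maximizing $z(S_i\cup\{k\})$ over $k\notin S_i$, set $S_{i+1}=S_i\cup\{k\}$ and $i\leftarrow i+1$; finally return $S_i$.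
   Formalization: The costs $c_j$, rewards $r_j$ and success probabilities $\pi_j$, together with their common value $\pi$, are rational numbers. -}

module Defs where

open import Data.Nat using (ℕ; zero; suc)
open import Data.Fin using (Fin; zero; suc)
open import Data.Bool using (true; false)
open import Data.Vec using ([]; _∷_)
open import Data.List using (List; []; _∷_; [_]; map; concatMap)
open import Data.Rational using (ℚ; 0ℚ; 1ℚ; _+_; _*_; _-_; _⊔_; _≤_; _<_)
open import Data.Fin.Subset using (Subset; _∪_; ⁅_⁆; _∉_; ⊥)
open import Data.Product using (_×_; ∃-syntax)

record Instance (n : ℕ) : Set where
  field
    cost   : Fin n → ℚ
    reward : Fin n → ℚ
    prob   : Fin n → ℚ

record Valid {n : ℕ} (I : Instance n) : Set where
  open Instance I
  field
    cost≥0   : ∀ j → 0ℚ ≤ cost j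
    reward≥0 : ∀ j → 0ℚ ≤ reward j
    prob≥0   : ∀ j → 0ℚ ≤ prob j
    prob≤1   : ∀ j → prob j ≤ 1ℚ

elements : ∀ {n} → Subset n → List (Fin n)
elements []          = []
elements (true ∷ p)  = zero ∷ map suc (elements p)
elements (false ∷ p) = map suc (elements p)

insertAll : ∀ {A : Set} → A → List A → List (List A)
insertAll x []       = [ x ∷ [] ]
insertAll x (y ∷ ys) = (x ∷ y ∷ ys) ∷ map (y ∷_) (insertAll x ys)

perms : ∀ {A : Set} → List A → List (List A)
perms []       = [ [] ]
perms (x ∷ xs) = concatMap (insertAll x) (perms xs)

maxList : ℚ → List ℚ → ℚ
maxList m []       = m
maxList m (x ∷ xs) = maxList (m ⊔ x) xs

module _ {n : ℕ} (I : Instance n) where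
  open Instance I

  -- Σ_k r_{σ(k)} ∏_{i≤k} π_{σ(i)}, with acc the running product ∏_{i<k} π_{σ(i)}
  expReward' : ℚ → List (Fin n) → ℚ
  expReward' acc []      = 0ℚ
  expReward' acc (j ∷ σ) = reward j * (acc * prob j) + expReward' (acc * prob j) σ

  expReward : List (Fin n) → ℚ
  expReward σ = expReward' 1ℚ σ

  totalCost : List (Fin n) → ℚ
  totalCost []      = 0ℚ
  totalCost (j ∷ σ) = cost j + totalCost σ

  zσ : Subset n → List (Fin n) → ℚ
  zσ S σ = expReward σ - totalCost (elements S)

  z : Subset n → ℚ
  z S with perms (elements S)
  ... | []     = 0ℚ   -- never happens: perms always nonempty
  ... | σ ∷ σs = maxList (zσ S σ) (map (zσ S) σs)

  -- Runs of the greedy algorithm (with arbitrary tie-breaking):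
  -- Greedy S T  means: started from current set S, the algorithm may return T.
  data Greedy : Subset n → Subset n → Set where
    stop : ∀ {S} → (∀ j → j ∉ S → z (S ∪ ⁅ j ⁆) ≤ z S) → Greedy S S
    step : ∀ {S T} (k : Fin n)
         → (∃[ j ] (j ∉ S × z S < z (S ∪ ⁅ j ⁆)))
         → k ∉ S
         → (∀ j → j ∉ S → z (S ∪ ⁅ j ⁆) ≤ z (S ∪ ⁅ k ⁆))
         → Greedy (S ∪ ⁅ k ⁆) T
         → Greedy S T

  GreedyOutput : Subset n → Set
  GreedyOutput T = Greedy ⊥ T

{-# OPTIONS --safe #-}
module Submission where

-- With a common success probability π, an optimal sequence of a set lists its jobs by decreasing
-- reward: swapping adjacent jobs to put the larger reward first raises the expected reward by a
-- multiple π^k·π(1 − π) ≥ 0 of the reward difference.  So z(S) is an explicit function of the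
-- sorted rewards of S, and it has the exchange property
--   |S| < |T|  ⇒  z(S) + z(T) ≤ z(S ∪ {j}) + z(T ∖ {j})  for some j ∈ T ∖ S.
-- Take for j the last job of T, in sorted order, that is not in S, and let P and Q be the jobs
-- of T before and after it.  Then Q ⊆ S, and S has at most |P| jobs besides Q.  Each job
-- inserted into a sorted list lowers the gain of inserting j afterwards by at most a factor π,
-- so adding j to S gains at least π^|P| times the gain of inserting j into Q, which is what
-- removing j from T loses.  By the exchange property the i-th greedy set is optimal among the
-- sets of size at most i, and such a set that no single job improves is optimal.

open import Defs
open import Data.Bool using (true; false)
open import Data.Empty using (⊥-elim)
open import Data.Fin using (zero; suc)
import Data.Fin.Properties as Fin
open import Data.Fin.Subset using (Subset; _∈_; _∉_; _∪_; ⁅_⁆; ⊥; ∣_∣) renaming (_-_ to _∖_)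
open import Data.Fin.Subset.Properties using (_∈?_; ∪-identityʳ; ∣⊥∣≡0)
open import Data.List using (List; []; _∷_; _++_; map; foldr; length)
open import Data.List.Membership.Propositional using () renaming (_∈_ to _∈ₗ_)
open import Data.List.Membership.Propositional.Properties
  using (∈-map⁺; ∈-map⁻; ∈-++⁺ˡ; ∈-++⁺ʳ; ∈-++⁻; ∈-∃++; ∈-concat⁺′; ∈-concat⁻′)
open import Data.List.Properties using (length-++; length-map)
open import Data.List.Relation.Binary.Permutation.Propositional
  using (_↭_; refl; prep; swap; trans; ↭-refl; ↭-reflexive; ↭-sym; ↭-trans; ↭⇒↭ₛ)
open import Data.List.Relation.Binary.Permutation.Propositional.Properties
  using (All-resp-↭; ∈-resp-↭; ↭-empty-inv; ↭-length; shift; drop-mid; ++-identityʳ; ++-comm)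
import Data.List.Relation.Binary.Permutation.Propositional.Properties as ↭
import Data.List.Relation.Binary.Permutation.Setoid.Properties as ↭ₛ
open import Data.List.Relation.Unary.All as All using (All; []; _∷_)
import Data.List.Relation.Unary.All.Properties as All
open import Data.List.Relation.Unary.AllPairs using (AllPairs; []; _∷_)
open import Data.List.Relation.Unary.Any using (here; there)
open import Data.List.Relation.Unary.Unique.Propositional using (Unique)
import Data.List.Relation.Unary.Unique.Propositional.Properties as Unique
open import Data.Nat as ℕ using (ℕ; zero; suc; z≤n; s≤s)
import Data.Nat.Properties as ℕ
open import Data.Product using (_×_; _,_; ∃-syntax)
open import Data.Rational
  using (ℚ; 0ℚ; 1ℚ; _+_; _*_; _-_; -_; _⊔_; _≤_; _<_; nonNegative; +-*-rawSemiring)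
open import Data.Rational.Properties
open import Data.Rational.Solver using (module +-*-Solver)
open import Algebra.Definitions.RawSemiring +-*-rawSemiring using (_^_)
open import Data.Sum using (_⊎_; inj₁; inj₂)
open import Data.Vec using ([]; _∷_; here; there)
open import Data.Vec.Properties using (zipWith-identityʳ)
open import Function using (_∘_)
open import Relation.Binary.PropositionalEquality
  using (_≡_; _≢_; refl; sym; cong; cong₂; subst; subst₂; setoid; module ≡-Reasoning)
  renaming (trans to ≡-trans)
open import Relation.Nullary using (¬_; yes; no)
open import Relation.Unary using (Decidable)
open +-*-Solver

p≤q⇒0≤q-p : ∀ {p q} → p ≤ q → 0ℚ ≤ q - p
p≤q⇒0≤q-p {p} {q} p≤q = subst (_≤ q - p) (+-inverseʳ p) (+-monoˡ-≤ (- p) p≤q)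

0≤q-p⇒p≤q : ∀ {p q} → 0ℚ ≤ q - p → p ≤ q
0≤q-p⇒p≤q {p} {q} 0≤q-p =
  subst₂ _≤_ (+-identityʳ p) (solve 2 (λ p q → p :+ (q :- p) := q) refl p q) (+-monoʳ-≤ p 0≤q-p)

p≤p+q : ∀ {p q} → 0ℚ ≤ q → p ≤ p + q
p≤p+q {p} {q} 0≤q = subst (_≤ p + q) (+-identityʳ p) (+-monoʳ-≤ p 0≤q)

*-nonNeg : ∀ {p q} → 0ℚ ≤ p → 0ℚ ≤ q → 0ℚ ≤ p * q
*-nonNeg {p} {q} 0≤p 0≤q = subst (_≤ p * q) (*-zeroʳ p) (*-monoˡ-≤-nonNeg p {{nonNegative 0≤p}} 0≤q)

+-cancelˡ-≤ : ∀ p {q r} → p + q ≤ p + r → q ≤ r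
+-cancelˡ-≤ p {q} {r} p+q≤p+r = subst₂ _≤_ (cancel q) (cancel r) (+-monoʳ-≤ (- p) p+q≤p+r)
  where
  cancel : ∀ x → - p + (p + x) ≡ x
  cancel x = solve 2 (λ p x → :- p :+ (p :+ x) := x) refl p x

[p+q]-[r+s]≡[p-s]+[q-r] : ∀ p q r s → (p + q) - (r + s) ≡ (p - s) + (q - r)
[p+q]-[r+s]≡[p-s]+[q-r] = solve 4 (λ p q r s → (p :+ q) :- (r :+ s) := (p :- s) :+ (q :- r)) refl

maxList-upper : ∀ {x} m xs → x ∈ₗ m ∷ xs → x ≤ maxList m xs
maxList-upper m []       (here refl)         = ≤-refl
maxList-upper m (y ∷ xs) (here refl)          =
  ≤-trans (p≤p⊔q m y) (maxList-upper (m ⊔ y) xs (here refl))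
maxList-upper m (y ∷ xs) (there (here refl))  =
  ≤-trans (p≤q⊔p m y) (maxList-upper (m ⊔ y) xs (here refl))
maxList-upper m (y ∷ xs) (there (there x∈xs)) = maxList-upper (m ⊔ y) xs (there x∈xs)

maxList-least : ∀ {b} m xs → All (_≤ b) (m ∷ xs) → maxList m xs ≤ b
maxList-least m []       (m≤b ∷ [])          = m≤b
maxList-least m (x ∷ xs) (m≤b ∷ x≤b ∷ xs≤b) = maxList-least (m ⊔ x) xs (⊔-lub m≤b x≤b ∷ xs≤b)

module _ {A : Set} where

  ∈-insertAll : ∀ (x : A) P Q → P ++ x ∷ Q ∈ₗ insertAll x (P ++ Q)
  ∈-insertAll x []      []      = here refl
  ∈-insertAll x []      (y ∷ Q) = here refl
  ∈-insertAll x (a ∷ P) Q       = there (∈-map⁺ (a ∷_) (∈-insertAll x P Q))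

  ↭⇒∈-perms : ∀ {σ : List A} xs → σ ↭ xs → σ ∈ₗ perms xs
  ↭⇒∈-perms []       σ↭[] rewrite ↭-empty-inv σ↭[] = here refl
  ↭⇒∈-perms (x ∷ xs) σ↭x∷xs with ∈-∃++ (∈-resp-↭ (↭-sym σ↭x∷xs) (here refl))
  ... | P , Q , refl =
    ∈-concat⁺′ (∈-insertAll x P Q) (∈-map⁺ (insertAll x) (↭⇒∈-perms xs (drop-mid P [] σ↭x∷xs)))

  ∈-insertAll⇒↭ : ∀ (x : A) τ {σ} → σ ∈ₗ insertAll x τ → σ ↭ x ∷ τ
  ∈-insertAll⇒↭ x []      (here refl) = ↭-refl
  ∈-insertAll⇒↭ x (y ∷ τ) (here refl) = ↭-refl
  ∈-insertAll⇒↭ x (y ∷ τ) (there σ∈) with ∈-map⁻ (y ∷_) σ∈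
  ... | σ′ , σ′∈ , refl = ↭-trans (prep y (∈-insertAll⇒↭ x τ σ′∈)) (swap y x ↭-refl)

  ∈-perms⇒↭ : ∀ xs {σ : List A} → σ ∈ₗ perms xs → σ ↭ xs
  ∈-perms⇒↭ []       (here refl) = ↭-refl
  ∈-perms⇒↭ (x ∷ xs) σ∈ with ∈-concat⁻′ (map (insertAll x) (perms xs)) σ∈
  ... | ys , σ∈ys , ys∈ with ∈-map⁻ (insertAll x) ys∈
  ... | τ , τ∈ , refl = ↭-trans (∈-insertAll⇒↭ x τ σ∈ys) (prep x (∈-perms⇒↭ xs τ∈))

  AllPairs-++⁻ʳ : ∀ {R : A → A → Set} xs {ys} → AllPairs R (xs ++ ys) → AllPairs R ys
  AllPairs-++⁻ʳ []       ys = ys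
  AllPairs-++⁻ʳ (x ∷ xs) (_ ∷ xs++ys) = AllPairs-++⁻ʳ xs xs++ys

  Unique-resp-↭ : ∀ {xs ys : List A} → xs ↭ ys → Unique xs → Unique ys
  Unique-resp-↭ xs↭ys = ↭ₛ.Unique-resp-↭ (setoid A) (↭⇒↭ₛ xs↭ys)

  ∈-++-∷⇒∈-++ : ∀ {x y : A} P {Q} → y ∈ₗ P ++ x ∷ Q → x ≢ y → y ∈ₗ P ++ Q
  ∈-++-∷⇒∈-++ P y∈ x≢y with ∈-++⁻ P y∈
  ... | inj₁ y∈P         = ∈-++⁺ˡ y∈P
  ... | inj₂ (here refl) = ⊥-elim (x≢y refl)
  ... | inj₂ (there y∈Q) = ∈-++⁺ʳ P y∈Q

  ∃-complement : ∀ {xs ys : List A} → Unique xs → All (_∈ₗ ys) xs → ∃[ zs ] xs ++ zs ↭ ys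
  ∃-complement {[]}     {ys} _ _ = ys , ↭-refl
  ∃-complement {x ∷ xs} (x∉xs ∷ u) (x∈ys ∷ xs⊆ys) with ∈-∃++ x∈ys
  ... | P , Q , refl
    with ∃-complement u (All.zipWith (λ (x≢y , y∈) → ∈-++-∷⇒∈-++ P y∈ x≢y) (x∉xs , xs⊆ys))
  ... | zs , xs++zs↭ = zs , ↭-trans (prep x xs++zs↭) (↭-sym (shift x P Q))

  unique-⊆⇒length-≤ : ∀ {xs ys : List A} → Unique xs → All (_∈ₗ ys) xs → length xs ℕ.≤ length ys
  unique-⊆⇒length-≤ {xs} unique xs⊆ys with ∃-complement unique xs⊆ys
  ... | zs , xs++zs↭ =
    subst (length xs ℕ.≤_) (≡-trans (sym (length-++ xs)) (↭-length xs++zs↭)) (ℕ.m≤m+n _ _)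

  all⊎last-counterexample : ∀ {P : A → Set} → Decidable P → ∀ xs →
    All P xs ⊎ ∃[ ys ] ∃[ x ] ∃[ zs ] (xs ≡ ys ++ x ∷ zs × ¬ P x × All P zs)
  all⊎last-counterexample P? [] = inj₁ []
  all⊎last-counterexample P? (x ∷ xs) with all⊎last-counterexample P? xs
  ... | inj₂ (ys , y , zs , refl , ¬Py , Pzs) = inj₂ (x ∷ ys , y , zs , refl , ¬Py , Pzs)
  ... | inj₁ Pxs with P? x
  ...   | yes Px = inj₁ (Px ∷ Pxs)
  ...   | no ¬Px = inj₂ ([] , x , xs , refl , ¬Px , Pxs)

∈⇒∈-elements : ∀ {m} {S : Subset m} {x} → x ∈ S → x ∈ₗ elements S
∈⇒∈-elements {S = true ∷ S}  here       = here refl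
∈⇒∈-elements {S = true ∷ S}  (there x∈) = there (∈-map⁺ suc (∈⇒∈-elements x∈))
∈⇒∈-elements {S = false ∷ S} (there x∈) = ∈-map⁺ suc (∈⇒∈-elements x∈)

∈-elements⇒∈ : ∀ {m} (S : Subset m) {x} → x ∈ₗ elements S → x ∈ S
∈-elements⇒∈ (true ∷ S) (here refl) = here
∈-elements⇒∈ (true ∷ S) (there x∈) with ∈-map⁻ suc x∈
... | y , y∈ , refl = there (∈-elements⇒∈ S y∈)
∈-elements⇒∈ (false ∷ S) x∈ with ∈-map⁻ suc x∈
... | y , y∈ , refl = there (∈-elements⇒∈ S y∈)

elements-unique : ∀ {m} (S : Subset m) → Unique (elements S)
elements-unique []          = []
elements-unique (true ∷ S)  = All.tabulate zero∉ ∷ Unique.map⁺ Fin.suc-injective (elements-unique S)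
  where
  zero∉ : ∀ {y} → y ∈ₗ map suc (elements S) → zero ≢ y
  zero∉ y∈ with ∈-map⁻ suc y∈
  ... | _ , _ , refl = λ ()
elements-unique (false ∷ S) = Unique.map⁺ Fin.suc-injective (elements-unique S)

elements-∪ : ∀ {m} {S : Subset m} {j} → j ∉ S → elements (S ∪ ⁅ j ⁆) ↭ j ∷ elements S
elements-∪ {S = true ∷ S}  {j = zero}  j∉S = ⊥-elim (j∉S here)
elements-∪ {S = false ∷ S} {j = zero}  j∉S rewrite ∪-identityʳ S = ↭-refl
elements-∪ {S = true ∷ S}  {j = suc j} j∉S =
  ↭-trans (prep zero (↭.map⁺ suc (elements-∪ (j∉S ∘ there)))) (swap zero (suc j) ↭-refl)
elements-∪ {S = false ∷ S} {j = suc j} j∉S = ↭.map⁺ suc (elements-∪ (j∉S ∘ there))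

elements-∖ : ∀ {m} {T : Subset m} {j} → j ∈ T → elements T ↭ j ∷ elements (T ∖ j)
-- T ∖ zero unfolds to a zipWith whose difference function is a where-bound closure over
-- its arguments, so p─⊥≡p does not match it; zipWith-identityʳ does.
elements-∖ {T = true ∷ T}  {j = zero}  here =
  ↭-reflexive (cong (λ U → zero ∷ map suc (elements U)) (sym (zipWith-identityʳ (λ _ → refl) T)))
elements-∖ {T = true ∷ T}  {j = suc j} (there j∈T) =
  ↭-trans (prep zero (↭.map⁺ suc (elements-∖ j∈T))) (swap zero (suc j) ↭-refl)
elements-∖ {T = false ∷ T} {j = suc j} (there j∈T) = ↭.map⁺ suc (elements-∖ j∈T)

length-elements : ∀ {m} (S : Subset m) → length (elements S) ≡ ∣ S ∣
length-elements []          = refl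
length-elements (true ∷ S)  = cong suc (≡-trans (length-map suc (elements S)) (length-elements S))
length-elements (false ∷ S) = ≡-trans (length-map suc (elements S)) (length-elements S)

x∉p⇒∣p∪⁅x⁆∣≡1+∣p∣ : ∀ {m} {p : Subset m} {x} → x ∉ p → ∣ p ∪ ⁅ x ⁆ ∣ ≡ suc ∣ p ∣
x∉p⇒∣p∪⁅x⁆∣≡1+∣p∣ {p = p} {x} x∉p = begin
  ∣ p ∪ ⁅ x ⁆ ∣                  ≡⟨ sym (length-elements (p ∪ ⁅ x ⁆)) ⟩
  length (elements (p ∪ ⁅ x ⁆))  ≡⟨ ↭-length (elements-∪ x∉p) ⟩
  suc (length (elements p))      ≡⟨ cong suc (length-elements p) ⟩
  suc ∣ p ∣                      ∎
  where open ≡-Reasoning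

x∈p⇒∣p∣≡1+∣p∖x∣ : ∀ {m} {p : Subset m} {x} → x ∈ p → ∣ p ∣ ≡ suc ∣ p ∖ x ∣
x∈p⇒∣p∣≡1+∣p∖x∣ {p = p} {x} x∈p = begin
  ∣ p ∣                          ≡⟨ sym (length-elements p) ⟩
  length (elements p)            ≡⟨ ↭-length (elements-∖ x∈p) ⟩
  suc (length (elements (p ∖ x))) ≡⟨ cong suc (length-elements (p ∖ x)) ⟩
  suc ∣ p ∖ x ∣                  ∎
  where open ≡-Reasoning

∣p∣≡0⇒p≡⊥ : ∀ {m} (p : Subset m) → ∣ p ∣ ≡ 0 → p ≡ ⊥
∣p∣≡0⇒p≡⊥ []          _      = refl
∣p∣≡0⇒p≡⊥ (false ∷ p) ∣p∣≡0 = cong (false ∷_) (∣p∣≡0⇒p≡⊥ p ∣p∣≡0)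

module _ {n} (I : Instance n) where

  zσ≤z : ∀ S {σ} → σ ↭ elements S → zσ I S σ ≤ z I S
  zσ≤z S σ↭ with perms (elements S) | ↭⇒∈-perms (elements S) σ↭
  ... | τ ∷ τs | σ∈ = maxList-upper _ _ (∈-map⁺ (zσ I S) σ∈)

  z≤ : ∀ S {b} → (∀ {σ} → σ ↭ elements S → zσ I S σ ≤ b) → z I S ≤ b
  z≤ S zσ≤b with perms (elements S) | ↭⇒∈-perms (elements S) ↭-refl | ∈-perms⇒↭ (elements S)
  ... | τ ∷ τs | _ | ∈⇒↭ = maxList-least _ _ (All.map⁺ (All.tabulate (zσ≤b ∘ ∈⇒↭)))

module Discounted {A : Set} (r : A → ℚ) (0≤r : ∀ x → 0ℚ ≤ r x)
                  (π : ℚ) (0≤π : 0ℚ ≤ π) (π≤1 : π ≤ 1ℚ) where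

  payoff : List A → ℚ
  payoff []      = 0ℚ
  payoff (x ∷ σ) = π * (r x + payoff σ)

  Sorted : List A → Set
  Sorted = AllPairs (λ x y → r y ≤ r x)

  π*-mono : ∀ {p q} → p ≤ q → π * p ≤ π * q
  π*-mono = *-monoˡ-≤-nonNeg π {{nonNegative 0≤π}}

  π*p≤p : ∀ {p} → 0ℚ ≤ p → π * p ≤ p
  π*p≤p {p} 0≤p = subst (π * p ≤_) (*-identityˡ p) (*-monoʳ-≤-nonNeg p {{nonNegative 0≤p}} π≤1)

  0≤1-π : 0ℚ ≤ 1ℚ - π
  0≤1-π = p≤q⇒0≤q-p π≤1

  payoff-∷-mono : ∀ x σ τ → payoff σ ≤ payoff τ → payoff (x ∷ σ) ≤ payoff (x ∷ τ)
  payoff-∷-mono x _ _ σ≤τ = π*-mono (+-monoʳ-≤ (r x) σ≤τ)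

  payoff-swap : ∀ {a x} σ → r a ≤ r x → payoff (a ∷ x ∷ σ) ≤ payoff (x ∷ a ∷ σ)
  payoff-swap {a} {x} σ a≤x =
    0≤q-p⇒p≤q (subst (0ℚ ≤_) difference (*-nonNeg 0≤π (*-nonNeg 0≤1-π (p≤q⇒0≤q-p a≤x))))
    where
    difference : π * ((1ℚ - π) * (r x - r a)) ≡ payoff (x ∷ a ∷ σ) - payoff (a ∷ x ∷ σ)
    difference = solve 4 (λ π x a p → π :* ((con 1ℚ :- π) :* (x :- a))
                                     := π :* (x :+ π :* (a :+ p)) :- π :* (a :+ π :* (x :+ p)))
                         refl π (r x) (r a) (payoff σ)

  payoff-≤-to-front : ∀ {x} P Q → All (λ a → r a ≤ r x) P →
                      payoff (P ++ x ∷ Q) ≤ payoff (x ∷ P ++ Q)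
  payoff-≤-to-front []      Q []          = ≤-refl
  payoff-≤-to-front (a ∷ P) Q (a≤x ∷ P≤x) =
    ≤-trans (payoff-∷-mono a (P ++ _ ∷ Q) (_ ∷ P ++ Q) (payoff-≤-to-front P Q P≤x))
            (payoff-swap (P ++ Q) a≤x)

  sorted-maximizes-payoff : ∀ {σ τ} → Sorted σ → τ ↭ σ → payoff τ ≤ payoff σ
  sorted-maximizes-payoff {[]}    []          τ↭[] rewrite ↭-empty-inv τ↭[] = ≤-refl
  sorted-maximizes-payoff {x ∷ σ} (σ≤x ∷ sorted) τ↭ with ∈-∃++ (∈-resp-↭ (↭-sym τ↭) (here refl))
  ... | P , Q , refl =
    ≤-trans (payoff-≤-to-front P Q P≤x)
            (payoff-∷-mono x (P ++ Q) σ (sorted-maximizes-payoff sorted (drop-mid P [] τ↭)))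
    where
    P≤x : All (λ a → r a ≤ r x) P
    P≤x = All.++⁻ˡ P (All-resp-↭ (↭-sym τ↭) (≤-refl ∷ σ≤x))

  insert : A → List A → List A
  insert j []      = j ∷ []
  insert j (x ∷ σ) with r x ≤? r j
  ... | yes _ = j ∷ x ∷ σ
  ... | no  _ = x ∷ insert j σ

  insert-↭ : ∀ j σ → insert j σ ↭ j ∷ σ
  insert-↭ j []      = ↭-refl
  insert-↭ j (x ∷ σ) with r x ≤? r j
  ... | yes _ = ↭-refl
  ... | no  _ = ↭-trans (prep x (insert-↭ j σ)) (swap x j ↭-refl)

  insert-sorted : ∀ j {σ} → Sorted σ → Sorted (insert j σ)
  insert-sorted j {[]}    []             = [] ∷ []
  insert-sorted j {x ∷ σ} (σ≤x ∷ sorted) with r x ≤? r j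
  ... | yes x≤j = (x≤j ∷ All.map (λ y≤x → ≤-trans y≤x x≤j) σ≤x) ∷ σ≤x ∷ sorted
  ... | no  x≰j = All-resp-↭ (↭-sym (insert-↭ j σ)) (<⇒≤ (≰⇒> x≰j) ∷ σ≤x) ∷ insert-sorted j sorted

  foldr-insert-↭ : ∀ Q E → foldr insert Q E ↭ E ++ Q
  foldr-insert-↭ Q []      = ↭-refl
  foldr-insert-↭ Q (e ∷ E) = ↭-trans (insert-↭ e (foldr insert Q E)) (prep e (foldr-insert-↭ Q E))

  foldr-insert-sorted : ∀ {Q} E → Sorted Q → Sorted (foldr insert Q E)
  foldr-insert-sorted []      sorted = sorted
  foldr-insert-sorted (e ∷ E) sorted = insert-sorted e (foldr-insert-sorted E sorted)

  -- gain j σ is what inserting j into a sorted σ adds to the payoff (payoff-insert): placed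
  -- below x it earns π · gain j σ, and placed above x it earns in addition the bonus
  -- π(1 − π)(r j − r x) of swapping it past x (payoff-swap).
  overtake : A → A → ℚ
  overtake j x = π * ((1ℚ - π) * ((r j - r x) ⊔ 0ℚ))

  gain : A → List A → ℚ
  gain j []      = π * r j
  gain j (x ∷ σ) = π * gain j σ + overtake j x

  overtake-nonNeg : ∀ j x → 0ℚ ≤ overtake j x
  overtake-nonNeg j x = *-nonNeg 0≤π (*-nonNeg 0≤1-π (p≤q⊔p (r j - r x) 0ℚ))

  overtake-≤ : ∀ {j x} → r x ≤ r j → overtake j x ≡ π * ((1ℚ - π) * (r j - r x))
  overtake-≤ x≤j = cong (λ d → π * ((1ℚ - π) * d)) (p≥q⇒p⊔q≡p (p≤q⇒0≤q-p x≤j))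

  overtake-≰ : ∀ {j x} → ¬ r x ≤ r j → overtake j x ≡ 0ℚ
  overtake-≰ {j} {x} x≰j = ≡-trans (cong (λ d → π * ((1ℚ - π) * d)) (p≤q⇒p⊔q≡q j-x≤0))
                                   (solve 1 (λ π → π :* ((con 1ℚ :- π) :* con 0ℚ) := con 0ℚ) refl π)
    where
    j-x≤0 : r j - r x ≤ 0ℚ
    j-x≤0 = subst (r j - r x ≤_) (+-inverseʳ (r x)) (+-monoˡ-≤ (- r x) (<⇒≤ (≰⇒> x≰j)))

  gain-nonNeg : ∀ j σ → 0ℚ ≤ gain j σ
  gain-nonNeg j []      = *-nonNeg 0≤π (0≤r j)
  gain-nonNeg j (x ∷ σ) = +-mono-≤ (*-nonNeg 0≤π (gain-nonNeg j σ)) (overtake-nonNeg j x)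

  gain-dominating : ∀ {j σ} → All (λ a → r a ≤ r j) σ → gain j σ ≡ π * r j - (1ℚ - π) * payoff σ
  gain-dominating {j} {[]}    [] =
    solve 2 (λ π y → π :* y := π :* y :- (con 1ℚ :- π) :* con 0ℚ) refl π (r j)
  gain-dominating {j} {x ∷ σ} (x≤j ∷ σ≤j) rewrite gain-dominating σ≤j | overtake-≤ x≤j =
    solve 4 (λ π y a p → π :* (π :* y :- (con 1ℚ :- π) :* p) :+ π :* ((con 1ℚ :- π) :* (y :- a))
                         := π :* y :- (con 1ℚ :- π) :* (π :* (a :+ p)))
            refl π (r j) (r x) (payoff σ)

  payoff-∷ : ∀ {j σ} → All (λ a → r a ≤ r j) σ → payoff (j ∷ σ) ≡ payoff σ + gain j σ
  payoff-∷ {j} {σ} σ≤j rewrite gain-dominating σ≤j =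
    solve 3 (λ π y p → π :* (y :+ p) := p :+ (π :* y :- (con 1ℚ :- π) :* p)) refl π (r j) (payoff σ)

  payoff-insert : ∀ j {σ} → Sorted σ → payoff (insert j σ) ≡ payoff σ + gain j σ
  payoff-insert j {[]}    [] = solve 2 (λ π y → π :* (y :+ con 0ℚ) := con 0ℚ :+ π :* y) refl π (r j)
  payoff-insert j {x ∷ σ} (σ≤x ∷ sorted) with r x ≤? r j
  ... | yes x≤j = payoff-∷ (x≤j ∷ All.map (λ y≤x → ≤-trans y≤x x≤j) σ≤x)
  ... | no  x≰j rewrite payoff-insert j sorted | overtake-≰ x≰j =
    solve 4 (λ π a p g → π :* (a :+ (p :+ g)) := π :* (a :+ p) :+ (π :* g :+ con 0ℚ))
            refl π (r x) (payoff σ) (gain j σ)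

  gain-insert : ∀ j k σ → π * gain j σ ≤ gain j (insert k σ)
  gain-insert j k []      = p≤p+q (overtake-nonNeg j k)
  gain-insert j k (x ∷ σ) with r x ≤? r k
  ... | yes _ = p≤p+q (overtake-nonNeg j k)
  ... | no  _ = begin
    π * (π * gain j σ + overtake j x)
      ≡⟨ *-distribˡ-+ π (π * gain j σ) (overtake j x) ⟩
    π * (π * gain j σ) + π * overtake j x
      ≤⟨ +-monoʳ-≤ (π * (π * gain j σ)) (π*p≤p (overtake-nonNeg j x)) ⟩
    π * (π * gain j σ) + overtake j x
      ≤⟨ +-monoˡ-≤ (overtake j x) (π*-mono (gain-insert j k σ)) ⟩
    π * gain j (insert k σ) + overtake j x
      ∎
    where open ≤-Reasoning

  π^-nonNeg : ∀ k → 0ℚ ≤ π ^ k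
  π^-nonNeg zero    = nonNegative⁻¹ 1ℚ
  π^-nonNeg (suc k) = *-nonNeg 0≤π (π^-nonNeg k)

  π^-antimono : ∀ {k l} → k ℕ.≤ l → π ^ l ≤ π ^ k
  π^-antimono {zero}  {zero}  _         = ≤-refl
  π^-antimono {zero}  {suc l} _         = ≤-trans (π*p≤p (π^-nonNeg l)) (π^-antimono {zero} {l} z≤n)
  π^-antimono {suc k} {suc l} (s≤s k≤l) = π*-mono (π^-antimono k≤l)

  gain-foldr-insert : ∀ j Q E → π ^ length E * gain j Q ≤ gain j (foldr insert Q E)
  gain-foldr-insert j Q []      = ≤-reflexive (*-identityˡ (gain j Q))
  gain-foldr-insert j Q (e ∷ E) = begin
    π * π ^ length E * gain j Q          ≡⟨ *-assoc π (π ^ length E) (gain j Q) ⟩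
    π * (π ^ length E * gain j Q)        ≤⟨ π*-mono (gain-foldr-insert j Q E) ⟩
    π * gain j (foldr insert Q E)        ≤⟨ gain-insert j e (foldr insert Q E) ⟩
    gain j (insert e (foldr insert Q E)) ∎
    where open ≤-Reasoning

  payoff-++-∷ : ∀ {j} P {Q} → All (λ a → r a ≤ r j) Q →
                payoff (P ++ j ∷ Q) ≡ payoff (P ++ Q) + π ^ length P * gain j Q
  payoff-++-∷ {j} []      {Q} Q≤j =
    ≡-trans (payoff-∷ Q≤j) (cong (payoff Q +_) (sym (*-identityˡ (gain j Q))))
  payoff-++-∷ {j} (a ∷ P) {Q} Q≤j rewrite payoff-++-∷ P Q≤j =
    solve 5 (λ π a p w g → π :* (a :+ (p :+ w :* g)) := π :* (a :+ p) :+ π :* w :* g)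
            refl π (r a) (payoff (P ++ Q)) (π ^ length P) (gain j Q)

Exchange : ∀ {n} → (Subset n → ℚ) → Set
Exchange f = ∀ S T → ∣ S ∣ ℕ.< ∣ T ∣ →
             ∃[ j ] (j ∈ T × j ∉ S × f S + f T ≤ f (S ∪ ⁅ j ⁆) + f (T ∖ j))

OptimalUpToSize : ∀ {n} → (Subset n → ℚ) → Subset n → Set
OptimalUpToSize f S = ∀ T → ∣ T ∣ ℕ.≤ ∣ S ∣ → f T ≤ f S

optimalUpToSize-⊥ : ∀ {n} {f : Subset n → ℚ} → OptimalUpToSize f ⊥
optimalUpToSize-⊥ {n} {f} T ∣T∣≤∣⊥∣ =
  ≤-reflexive (cong f (∣p∣≡0⇒p≡⊥ T (ℕ.n≤0⇒n≡0 (subst (∣ T ∣ ℕ.≤_) (∣⊥∣≡0 n) ∣T∣≤∣⊥∣))))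

module _ {n} {f : Subset n → ℚ} (exchange : Exchange f) where

  optimalUpToSize-∪ : ∀ {S j₀ k} → OptimalUpToSize f S → j₀ ∉ S → f S < f (S ∪ ⁅ j₀ ⁆) → k ∉ S →
                      (∀ j → j ∉ S → f (S ∪ ⁅ j ⁆) ≤ f (S ∪ ⁅ k ⁆)) → OptimalUpToSize f (S ∪ ⁅ k ⁆)
  optimalUpToSize-∪ {S} {j₀} {k} optimal j₀∉S improves k∉S best T ∣T∣≤ with ∣ T ∣ ℕ.≤? ∣ S ∣
  ... | yes ∣T∣≤∣S∣ = ≤-trans (optimal T ∣T∣≤∣S∣) (≤-trans (<⇒≤ improves) (best j₀ j₀∉S))
  ... | no  ∣T∣≰∣S∣ with exchange S T (ℕ.≰⇒> ∣T∣≰∣S∣)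
  ...   | j , j∈T , j∉S , exch = ≤-trans (+-cancelˡ-≤ (f S) S+T≤S+[S∪j]) (best j j∉S)
    where
    ∣T∖j∣≤∣S∣ : ∣ T ∖ j ∣ ℕ.≤ ∣ S ∣
    ∣T∖j∣≤∣S∣ = ℕ.≤-pred (subst₂ ℕ._≤_ (x∈p⇒∣p∣≡1+∣p∖x∣ j∈T) (x∉p⇒∣p∪⁅x⁆∣≡1+∣p∣ k∉S) ∣T∣≤)
    S+T≤S+[S∪j] : f S + f T ≤ f S + f (S ∪ ⁅ j ⁆)
    S+T≤S+[S∪j] = begin
      f S + f T                 ≤⟨ exch ⟩
      f (S ∪ ⁅ j ⁆) + f (T ∖ j) ≤⟨ +-monoʳ-≤ (f (S ∪ ⁅ j ⁆)) (optimal (T ∖ j) ∣T∖j∣≤∣S∣) ⟩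
      f (S ∪ ⁅ j ⁆) + f S       ≡⟨ +-comm (f (S ∪ ⁅ j ⁆)) (f S) ⟩
      f S + f (S ∪ ⁅ j ⁆)       ∎
      where open ≤-Reasoning

  optimalUpToSize⇒optimal : ∀ {S} → OptimalUpToSize f S → (∀ j → j ∉ S → f (S ∪ ⁅ j ⁆) ≤ f S) →
                            ∀ T → f T ≤ f S
  optimalUpToSize⇒optimal {S} optimal noGain T = bounded ∣ T ∣ T ℕ.≤-refl
    where
    bounded : ∀ m U → ∣ U ∣ ℕ.≤ m → f U ≤ f S
    bounded zero    U ∣U∣≤0 = optimal U (ℕ.≤-trans ∣U∣≤0 z≤n)
    bounded (suc m) U ∣U∣≤ with ∣ U ∣ ℕ.≤? ∣ S ∣
    ... | yes ∣U∣≤∣S∣ = optimal U ∣U∣≤∣S∣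
    ... | no  ∣U∣≰∣S∣ with exchange S U (ℕ.≰⇒> ∣U∣≰∣S∣)
    ...   | j , j∈U , j∉S , exch =
      ≤-trans (+-cancelˡ-≤ (f S) (≤-trans exch (+-monoˡ-≤ (f (U ∖ j)) (noGain j j∉S))))
              (bounded m (U ∖ j) (ℕ.≤-pred (subst (ℕ._≤ suc m) (x∈p⇒∣p∣≡1+∣p∖x∣ j∈U) ∣U∣≤)))

greedy-optimal : ∀ {n} {I : Instance n} → Exchange (z I) →
                 ∀ {S T} → Greedy I S T → OptimalUpToSize (z I) S → ∀ X → z I X ≤ z I T
greedy-optimal exchange (stop noGain) optimal = optimalUpToSize⇒optimal exchange optimal noGain
greedy-optimal exchange (step k (j₀ , j₀∉S , improves) k∉S best run) optimal =
  greedy-optimal exchange run (optimalUpToSize-∪ exchange optimal j₀∉S improves k∉S best)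

module UniformProbability {n} (I : Instance n) (V : Valid I) (π : ℚ)
                          (prob≡π : ∀ j → Instance.prob I j ≡ π) (0≤π : 0ℚ ≤ π) (π≤1 : π ≤ 1ℚ) where
  open Instance I
  open Valid V
  open Discounted reward reward≥0 π 0≤π π≤1

  expReward'-uniform : ∀ a σ → expReward' I a σ ≡ a * payoff σ
  expReward'-uniform a []      = sym (*-zeroʳ a)
  expReward'-uniform a (j ∷ σ) rewrite prob≡π j | expReward'-uniform (a * π) σ =
    solve 4 (λ r a π p → r :* (a :* π) :+ (a :* π) :* p := a :* (π :* (r :+ p)))
            refl (reward j) a π (payoff σ)

  totalCost-↭ : ∀ {σ τ} → σ ↭ τ → totalCost I σ ≡ totalCost I τ
  totalCost-↭ refl                    = refl
  totalCost-↭ (prep x σ↭τ)            = cong (cost x +_) (totalCost-↭ σ↭τ)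
  totalCost-↭ (swap {ys = τ} x y σ↭τ) rewrite totalCost-↭ σ↭τ =
    solve 3 (λ a b c → a :+ (b :+ c) := b :+ (a :+ c)) refl (cost x) (cost y) (totalCost I τ)
  totalCost-↭ (trans σ↭ ↭τ)           = ≡-trans (totalCost-↭ σ↭) (totalCost-↭ ↭τ)

  costOf : Subset n → ℚ
  costOf S = totalCost I (elements S)

  zσ-uniform : ∀ S σ → zσ I S σ ≡ payoff σ - costOf S
  zσ-uniform S σ = cong (_- costOf S) (≡-trans (expReward'-uniform 1ℚ σ) (*-identityˡ (payoff σ)))

  payoff-costOf≤z : ∀ S {σ} → σ ↭ elements S → payoff σ - costOf S ≤ z I S
  payoff-costOf≤z S {σ} σ↭ = subst (_≤ z I S) (zσ-uniform S σ) (zσ≤z I S σ↭)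

  z-sorted : ∀ S {σ} → Sorted σ → σ ↭ elements S → z I S ≡ payoff σ - costOf S
  z-sorted S {σ} sorted σ↭ = ≤-antisym (z≤ I S zσ≤) (payoff-costOf≤z S σ↭)
    where
    zσ≤ : ∀ {τ} → τ ↭ elements S → zσ I S τ ≤ payoff σ - costOf S
    zσ≤ {τ} τ↭ = subst (_≤ payoff σ - costOf S) (sym (zσ-uniform S τ))
      (+-monoˡ-≤ (- costOf S) (sorted-maximizes-payoff sorted (↭-trans τ↭ (↭-sym σ↭))))

  z-∪ : ∀ {S j σ} → j ∉ S → Sorted σ → σ ↭ elements S →
        z I (S ∪ ⁅ j ⁆) ≡ z I S + (gain j σ - cost j)
  z-∪ {S} {j} {σ} j∉S sorted σ↭ = begin
    z I (S ∪ ⁅ j ⁆)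
      ≡⟨ z-sorted (S ∪ ⁅ j ⁆) (insert-sorted j sorted) insert↭ ⟩
    payoff (insert j σ) - costOf (S ∪ ⁅ j ⁆)
      ≡⟨ cong₂ _-_ (payoff-insert j sorted) (totalCost-↭ (elements-∪ j∉S)) ⟩
    (payoff σ + gain j σ) - (cost j + costOf S)
      ≡⟨ [p+q]-[r+s]≡[p-s]+[q-r] (payoff σ) (gain j σ) (cost j) (costOf S) ⟩
    (payoff σ - costOf S) + (gain j σ - cost j)
      ≡⟨ cong (_+ (gain j σ - cost j)) (sym (z-sorted S sorted σ↭)) ⟩
    z I S + (gain j σ - cost j)
      ∎
    where
    open ≡-Reasoning
    insert↭ : insert j σ ↭ elements (S ∪ ⁅ j ⁆)
    insert↭ = ↭-trans (insert-↭ j σ) (↭-trans (prep j σ↭) (↭-sym (elements-∪ j∉S)))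

  z-∖ : ∀ {T j} P {Q} → Sorted (P ++ j ∷ Q) → P ++ j ∷ Q ↭ elements T → j ∈ T →
        z I T ≤ z I (T ∖ j) + (π ^ length P * gain j Q - cost j)
  z-∖ {T} {j} P {Q} sorted σ↭ j∈T = begin
    z I T
      ≡⟨ z-sorted T sorted σ↭ ⟩
    payoff (P ++ j ∷ Q) - costOf T
      ≡⟨ cong₂ _-_ (payoff-++-∷ P Q≤j) (totalCost-↭ (elements-∖ j∈T)) ⟩
    (payoff (P ++ Q) + loss) - (cost j + costOf (T ∖ j))
      ≡⟨ [p+q]-[r+s]≡[p-s]+[q-r] (payoff (P ++ Q)) loss (cost j) (costOf (T ∖ j)) ⟩
    (payoff (P ++ Q) - costOf (T ∖ j)) + (loss - cost j)
      ≤⟨ +-monoˡ-≤ (loss - cost j) (payoff-costOf≤z (T ∖ j) P++Q↭) ⟩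
    z I (T ∖ j) + (loss - cost j)
      ∎
    where
    open ≤-Reasoning
    loss = π ^ length P * gain j Q
    P++Q↭ : P ++ Q ↭ elements (T ∖ j)
    P++Q↭ = drop-mid P [] (↭-trans σ↭ (elements-∖ j∈T))
    Q≤j : All (λ a → reward a ≤ reward j) Q
    Q≤j with AllPairs-++⁻ʳ P sorted
    ... | Q≤j ∷ _ = Q≤j

  exchange-at : ∀ {S T j} P Q → Sorted (P ++ j ∷ Q) → P ++ j ∷ Q ↭ elements T → j ∈ T → j ∉ S →
                All (_∈ S) Q → ∣ S ∣ ℕ.< ∣ T ∣ → z I S + z I T ≤ z I (S ∪ ⁅ j ⁆) + z I (T ∖ j)
  exchange-at {S} {T} {j} P Q sorted σ↭ j∈T j∉S Q⊆S ∣S∣<∣T∣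
    with AllPairs-++⁻ʳ P sorted | AllPairs-++⁻ʳ P (Unique-resp-↭ (↭-sym σ↭) (elements-unique T))
  ... | _ ∷ Q-sorted | _ ∷ Q-unique with ∃-complement Q-unique (All.map ∈⇒∈-elements Q⊆S)
  ... | E , Q++E↭ = begin
    z I S + z I T
      ≤⟨ +-monoʳ-≤ (z I S) (z-∖ P sorted σ↭ j∈T) ⟩
    z I S + (z I (T ∖ j) + (π ^ length P * gain j Q - cost j))
      ≤⟨ +-monoʳ-≤ (z I S) (+-monoʳ-≤ (z I (T ∖ j)) (+-monoˡ-≤ (- cost j) gain-≤)) ⟩
    z I S + (z I (T ∖ j) + (gain j σS - cost j))
      ≡⟨ solve 3 (λ a b c → a :+ (b :+ c) := (a :+ c) :+ b) refl
                 (z I S) (z I (T ∖ j)) (gain j σS - cost j) ⟩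
    (z I S + (gain j σS - cost j)) + z I (T ∖ j)
      ≡⟨ cong (_+ z I (T ∖ j)) (sym (z-∪ j∉S σS-sorted σS↭)) ⟩
    z I (S ∪ ⁅ j ⁆) + z I (T ∖ j)
      ∎
    where
    open ≤-Reasoning
    σS = foldr insert Q E
    σS↭ : σS ↭ elements S
    σS↭ = ↭-trans (foldr-insert-↭ Q E) (↭-trans (++-comm E Q) Q++E↭)
    σS-sorted : Sorted σS
    σS-sorted = foldr-insert-sorted E Q-sorted
    ∣S∣≡ : ∣ S ∣ ≡ length Q ℕ.+ length E
    ∣S∣≡ = ≡-trans (sym (length-elements S)) (≡-trans (sym (↭-length Q++E↭)) (length-++ Q))
    ∣T∣≡ : ∣ T ∣ ≡ suc (length Q ℕ.+ length P)
    ∣T∣≡ = ≡-trans (sym (length-elements T)) (≡-trans (sym (↭-length σ↭)) (≡-trans (length-++ P)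
             (≡-trans (ℕ.+-suc (length P) (length Q)) (cong suc (ℕ.+-comm (length P) (length Q))))))
    ∣E∣≤∣P∣ : length E ℕ.≤ length P
    ∣E∣≤∣P∣ = ℕ.+-cancelˡ-≤ (length Q) (length E) (length P)
                (ℕ.≤-pred (subst₂ (λ s t → suc s ℕ.≤ t) ∣S∣≡ ∣T∣≡ ∣S∣<∣T∣))
    gain-≤ : π ^ length P * gain j Q ≤ gain j σS
    gain-≤ = ≤-trans
      (*-monoʳ-≤-nonNeg (gain j Q) {{nonNegative (gain-nonNeg j Q)}} (π^-antimono ∣E∣≤∣P∣))
      (gain-foldr-insert j Q E)

  exchange-sorted : ∀ {S T σ} → Sorted σ → σ ↭ elements T → ∣ S ∣ ℕ.< ∣ T ∣ →
                    ∃[ j ] (j ∈ T × j ∉ S × z I S + z I T ≤ z I (S ∪ ⁅ j ⁆) + z I (T ∖ j))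
  exchange-sorted {S} {T} {σ} sorted σ↭ ∣S∣<∣T∣ with all⊎last-counterexample (_∈? S) σ
  ... | inj₁ σ⊆S = ⊥-elim (ℕ.<⇒≱ ∣S∣<∣T∣ ∣T∣≤∣S∣)
    where
    ∣T∣≤∣S∣ : ∣ T ∣ ℕ.≤ ∣ S ∣
    ∣T∣≤∣S∣ = subst₂ ℕ._≤_ (≡-trans (↭-length σ↭) (length-elements T)) (length-elements S)
      (unique-⊆⇒length-≤ (Unique-resp-↭ (↭-sym σ↭) (elements-unique T)) (All.map ∈⇒∈-elements σ⊆S))
  ... | inj₂ (P , j , Q , refl , j∉S , Q⊆S) =
    j , j∈T , j∉S , exchange-at P Q sorted σ↭ j∈T j∉S Q⊆S ∣S∣<∣T∣
    where
    j∈T : j ∈ T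
    j∈T = ∈-elements⇒∈ T (∈-resp-↭ σ↭ (∈-++⁺ʳ P (here refl)))

  exchange : Exchange (z I)
  exchange S T = exchange-sorted (foldr-insert-sorted (elements T) [])
                   (↭-trans (foldr-insert-↭ [] (elements T)) (++-identityʳ (elements T)))

theorem2 : ∀ {n : ℕ} (I : Instance n) → Valid I
         → (π : ℚ) → (∀ j → Instance.prob I j ≡ π)
         → ∀ (S* : Subset n) → GreedyOutput I S*
         → ∀ (S : Subset n) → z I S ≤ z I S*
-- Without jobs π is unconstrained; otherwise job zero shows 0 ≤ π ≤ 1.
theorem2 {zero}  I V π prob≡π [] run [] = ≤-refl
theorem2 {suc _} I V π prob≡π S* run S =
  greedy-optimal (UniformProbability.exchange I V π prob≡π 0≤π π≤1) run optimalUpToSize-⊥ S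
  where
  0≤π : 0ℚ ≤ π
  0≤π = subst (0ℚ ≤_) (prob≡π zero) (Valid.prob≥0 V zero)
  π≤1 : π ≤ 1ℚ
  π≤1 = subst (_≤ 1ℚ) (prob≡π zero) (Valid.prob≤1 V zero)
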